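{- Any process $\mathrm{Quantile}(\delta_1, \ldots, \delta_k)$ on $n$ bins majorizes the Two-Choice process, i.e. the probability vector of Two-Choice is majorized by that of $\mathrm{Quantile}(\delta_1,\ldots,\delta_k)$.
   Context: Bins are ranked by non-increasing current load (rank $1$ = most loaded). A process is described by its probability vector $p$, with $p_i$ the probability of placing the ball into the bin of rank $i$; $q$ majorizes $p$ if $\sum_{j \leq i} p_j \leq \sum_{j\leq i} q_j$ for all $i \in [n]$. For fixed quantiles $0 < \delta_1 < \cdots < \delta_k < 1$ (multiples of $1/n$), $\mathrm{Quantile}(\delta_1,\ldots,\delta_k)$ samples two bins independently and uniformly at random, assigns each sampled bin $j$ the index $\ell(j)$ with $\mathrm{rank}(j) \in (\delta_\ell n, \delta_{\ell+1} n]$ ($\delta_0=0$, $\delta_{k+1}=1$), and places the ball into the bin with the larger index, ties broken uniformly at random; its probability vector is $p_i = \delta_1/n$ for $i \leq \delta_1 n$, $(\delta_{j-1}+\delta_j)/n$ for $\delta_{j-1} n < i \leq \delta_j n$, and $(1+\delta_k)/n$ for $i > \delta_k n$. The Two-Choice process places each ball into the lesser loaded of two independently uniformly sampled bins; its probability vector is $p_i = (2i-1)/n^2$. -}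

module Defs where

open import Data.Nat using (ℕ; zero; suc; _+_; _*_; _∸_; _≤_; _<_; _≤ᵇ_)
open import Data.Bool using (if_then_else_)
open import Data.Vec using (Vec; []; _∷_)

-- Probability vectors of processes on n bins are indexed by rank i ∈ [1, n].
-- All probabilities here are rationals with denominator n², so we represent
-- a probability vector by its NUMERATORS over n²:  p_i = num i / n².

twoChoiceNum : ℕ → ℕ → ℕ
twoChoiceNum n i = 2 * i ∸ 1

-- Quantile(δ_1,…,δ_k) with δ_j = d_j / n.  p_i = (δ_{j-1} + δ_j)/n for
-- δ_{j-1} n < i ≤ δ_j n, with δ_0 = 0 and δ_{k+1} = 1; numerator over n²
-- is d_{j-1} + d_j (with d_0 = 0, d_{k+1} = n).
-- quantileNumFrom n prev ds i : prev is d_{j-1}, ds the remaining thresholds.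
quantileNumFrom : ℕ → ℕ → {k : ℕ} → Vec ℕ k → ℕ → ℕ
quantileNumFrom n prev []       i = prev + n
quantileNumFrom n prev (d ∷ ds) i =
  if i ≤ᵇ d then prev + d else quantileNumFrom n d ds i

quantileNum : (n : ℕ) {k : ℕ} → Vec ℕ k → ℕ → ℕ
quantileNum n ds i = quantileNumFrom n 0 ds i

prefixSum : (ℕ → ℕ) → ℕ → ℕ
prefixSum f zero    = 0
prefixSum f (suc i) = prefixSum f i + f (suc i)

Majorizes : ℕ → (q p : ℕ → ℕ) → Set
Majorizes n q p = ∀ i → 1 ≤ i → i ≤ n → prefixSum p i ≤ prefixSum q i

-- The Two-Choice numerators 2i − 1 have prefix sums i², so it suffices that the
-- Quantile prefix sums dominate i². On a run (a, b] between consecutive thresholds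
-- the Quantile numerator is the constant a + b, hence for a ≤ i ≤ b the prefix sum
-- grows from its value at a by (i − a)(a + b) ≥ (i − a)(a + i) = i² − a².
-- Starting from 0² = 0 and passing from run to run gives the bound everywhere.
module Submission where

open import Defs
open import Data.Nat using (ℕ; zero; suc; _+_; _*_; _∸_; _≤_; _<_; _≤ᵇ_; z≤n; s≤s)
open import Data.Nat.Properties
open import Data.Nat.Tactic.RingSolver using (solve-∀)
open import Data.Bool using (true; false)
open import Data.Fin using (Fin)
open import Data.Product using (_,_)
open import Function using (case_of_)
open import Data.Vec using (Vec; []; _∷_; lookup)
open import Data.Vec.Relation.Unary.Linked as Linked using (Linked; []; [-]; _∷_)
open import Relation.Binary.Core using (Rel)
open import Relation.Binary.PropositionalEquality
open import Relation.Nullary using (yes; no; contradiction)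
open import Relation.Nullary.Reflects using (ofʸ; ofⁿ)

prefixSum-twoChoiceNum : ∀ n i → prefixSum (twoChoiceNum n) i ≡ i * i
prefixSum-twoChoiceNum n zero    = refl
prefixSum-twoChoiceNum n (suc i) = begin
  prefixSum (twoChoiceNum n) i + (2 * suc i ∸ 1) ≡⟨ cong (_+ (2 * suc i ∸ 1)) (prefixSum-twoChoiceNum n i) ⟩
  i * i + (2 * suc i ∸ 1)                        ≡⟨ square-step i ⟩
  suc i * suc i                                  ∎
  where
  open ≡-Reasoning
  -- 2 * suc i ∸ 1 reduces to i + 1 * suc i, so this identity is ∸-free.
  square-step : ∀ i → i * i + (i + 1 * suc i) ≡ suc i * suc i
  square-step = solve-∀

prefixSum-constantRun : (q : ℕ → ℕ) (a c t : ℕ) → (∀ m → a < m → m ≤ a + t → q m ≡ c)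
  → prefixSum q (a + t) ≡ prefixSum q a + t * c
prefixSum-constantRun q a c zero    _ rewrite +-identityʳ a = sym (+-identityʳ _)
prefixSum-constantRun q a c (suc t) q≡c = begin
  prefixSum q (a + suc t)                 ≡⟨ cong (prefixSum q) (+-suc a t) ⟩
  prefixSum q (a + t) + q (suc (a + t))   ≡⟨ cong₂ _+_ (prefixSum-constantRun q a c t q≡c′)
                                                       (q≡c (suc (a + t)) (s≤s (m≤m+n a t)) (≤-reflexive (sym (+-suc a t)))) ⟩
  prefixSum q a + t * c + c               ≡⟨ +-assoc (prefixSum q a) (t * c) c ⟩
  prefixSum q a + (t * c + c)             ≡⟨ cong (prefixSum q a +_) (+-comm (t * c) c) ⟩
  prefixSum q a + suc t * c               ∎
  where
  open ≡-Reasoning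
  q≡c′ : ∀ m → a < m → m ≤ a + t → q m ≡ c
  q≡c′ m a<m m≤a+t = q≡c m a<m (≤-trans m≤a+t (+-monoʳ-≤ a (n≤1+n t)))

square≤prefixSum-onRun : (q : ℕ → ℕ) (a b : ℕ) → a * a ≤ prefixSum q a
  → (∀ m → a < m → m ≤ b → q m ≡ a + b)
  → ∀ i → a ≤ i → i ≤ b → i * i ≤ prefixSum q i
square≤prefixSum-onRun q a b a²≤ q≡a+b i a≤i i≤b with m≤n⇒∃[o]m+o≡n a≤i
... | t , refl = begin
  (a + t) * (a + t)           ≡⟨ square-expand a t ⟩
  a * a + t * (a + (a + t))   ≤⟨ +-mono-≤ a²≤ (*-monoʳ-≤ t (+-monoʳ-≤ a i≤b)) ⟩
  prefixSum q a + t * (a + b) ≡⟨ prefixSum-constantRun q a (a + b) t q≡a+b′ ⟨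
  prefixSum q (a + t)         ∎
  where
  open ≤-Reasoning
  square-expand : ∀ a t → (a + t) * (a + t) ≡ a * a + t * (a + (a + t))
  square-expand = solve-∀
  q≡a+b′ : ∀ m → a < m → m ≤ a + t → q m ≡ a + b
  q≡a+b′ m a<m m≤a+t = q≡a+b m a<m (≤-trans m≤a+t i≤b)

quantileNumFrom-≤ : ∀ n prev {k} d (ds : Vec ℕ k) {m} → m ≤ d
  → quantileNumFrom n prev (d ∷ ds) m ≡ prev + d
quantileNumFrom-≤ n prev d ds {m} m≤d with m ≤ᵇ d | ≤ᵇ-reflects-≤ m d
... | true  | _        = refl
... | false | ofⁿ m≰d = contradiction m≤d m≰d

quantileNumFrom-> : ∀ n prev {k} d (ds : Vec ℕ k) {m} → d < m
  → quantileNumFrom n prev (d ∷ ds) m ≡ quantileNumFrom n d ds m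
quantileNumFrom-> n prev d ds {m} d<m with m ≤ᵇ d | ≤ᵇ-reflects-≤ m d
... | true  | ofʸ m≤d = contradiction m≤d (<⇒≱ d<m)
... | false | _       = refl

square≤prefixSum-quantileNumFrom : ∀ n {k} (q : ℕ → ℕ) prev (ds : Vec ℕ k)
  → Linked _≤_ (prev ∷ ds)
  → prev * prev ≤ prefixSum q prev
  → (∀ m → prev < m → q m ≡ quantileNumFrom n prev ds m)
  → ∀ i → prev ≤ i → i ≤ n → i * i ≤ prefixSum q i
square≤prefixSum-quantileNumFrom n q prev [] _ prev²≤ q≡ i prev≤i i≤n =
  square≤prefixSum-onRun q prev n prev²≤ (λ m prev<m _ → q≡ m prev<m) i prev≤i i≤n
square≤prefixSum-quantileNumFrom n q prev (d ∷ ds) (prev≤d ∷ linked) prev²≤ q≡ i prev≤i i≤n =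
  case i ≤? d of λ where
    (yes i≤d) → square≤prefixSum-onRun q prev d prev²≤ q≡prev+d i prev≤i i≤d
    (no i≰d)  → square≤prefixSum-quantileNumFrom n q d ds linked d²≤ q≡beyond-d i (<⇒≤ (≰⇒> i≰d)) i≤n
  where
  q≡prev+d : ∀ m → prev < m → m ≤ d → q m ≡ prev + d
  q≡prev+d m prev<m m≤d = trans (q≡ m prev<m) (quantileNumFrom-≤ n prev d ds m≤d)
  d²≤ : d * d ≤ prefixSum q d
  d²≤ = square≤prefixSum-onRun q prev d prev²≤ q≡prev+d d prev≤d ≤-refl
  q≡beyond-d : ∀ m → d < m → q m ≡ quantileNumFrom n d ds m
  q≡beyond-d m d<m = trans (q≡ m (≤-<-trans prev≤d d<m)) (quantileNumFrom-> n prev d ds d<m)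

Linked-fromLookup : ∀ {a ℓ} {A : Set a} {R : Rel A ℓ} {k} (xs : Vec A k)
  → (∀ j j′ → j Data.Fin.< j′ → R (lookup xs j) (lookup xs j′))
  → Linked R xs
Linked-fromLookup []           _    = []
Linked-fromLookup (x ∷ [])     _    = [-]
Linked-fromLookup (x ∷ y ∷ xs) mono =
  mono Data.Fin.zero (Data.Fin.suc Data.Fin.zero) (s≤s z≤n)
  ∷ Linked-fromLookup (y ∷ xs) (λ j j′ j<j′ → mono (Data.Fin.suc j) (Data.Fin.suc j′) (s≤s j<j′))

corollary3p5 : (n k : ℕ) (d : Vec ℕ (suc k))
    → (∀ j → 0 < lookup d j)
    → (∀ j → lookup d j < n)
    → (∀ (j j′ : Fin (suc k)) → j Data.Fin.< j′ → lookup d j < lookup d j′)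
    → Majorizes n (quantileNum n d) (twoChoiceNum n)
corollary3p5 n k d@(_ ∷ _) 0<d _ increasing i _ i≤n = begin
  prefixSum (twoChoiceNum n) i ≡⟨ prefixSum-twoChoiceNum n i ⟩
  i * i                        ≤⟨ square≤prefixSum-quantileNumFrom n (quantileNum n d) 0 d
                                    thresholds z≤n (λ _ _ → refl) i z≤n i≤n ⟩
  prefixSum (quantileNum n d) i ∎
  where
  open ≤-Reasoning
  thresholds : Linked _≤_ (0 ∷ d)
  thresholds = <⇒≤ (0<d Data.Fin.zero) ∷ Linked.map <⇒≤ (Linked-fromLookup d increasing)
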